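{- For any diagram $D$ and any row index $r\ge1$, $\tilde e_r(D)\ne0$ if and only if $\tilde e_r(\mathrm{rect}(D))\neq0$, and in this case $\mathrm{rect}(\tilde e_r(D))=\tilde e_r(\mathrm{rect}(D))$.
   Context: A diagram is a finite set of cells $(r,c)$ with $r,c\ge1$ (row $r$, column $c$). Vertical $i$-pairing: pair cells in rows $i,i+1$ in the same column; then iteratively pair an unpaired cell in row $i+1$ with an unpaired cell in row $i$ in a column to its left whenever all cells of rows $i,i+1$ in the columns between them are already paired. $\tilde e_i$ moves the rightmost vertically unpaired cell of row $i+1$ down to row $i$; $\tilde e_i(D)=0$ if there is none. Horizontal $i$-pairing: pair cells in columns $i,i+1$ in the same row; then iteratively pair an unpaired cell in column $i+1$ with an unpaired cell in column $i$ in a row above it whenever all cells of columns $i,i+1$ in the rows between them are already paired. $\tilde E_i$ moves the bottom-most horizontally unpaired cell of column $i+1$ left to column $i$; $\tilde E_i(D)=0$ if there is none. Rectification: if $\tilde E_i(D)=0$ for all $i\ge1$ then $\mathrm{rect}(D)=D$; otherwise take the minimal $i$ with $\tilde E_i(D)\ne0$, replace $D$ by $\tilde E_i(D)$, and repeat. -}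

module Defs where

open import Data.Nat using (ℕ; zero; suc; _≡ᵇ_; _⊔_; _+_)
open import Data.Bool using (Bool; true; false; _∧_; if_then_else_)
open import Data.Bool.ListAction using (any)
open import Data.List using (List; []; _∷_; foldr; applyUpTo; reverse)
open import Data.Product using (_×_; _,_; proj₁; proj₂)
open import Data.Maybe using (Maybe; just; nothing)
open import Data.List.Membership.Propositional using (_∈_)
open import Function.Bundles using (_⇔_)
open import Data.List.Relation.Unary.All using (All)
open import Data.Nat using (_≤_)

-- A cell (r , c) : row r, column c (1-indexed; rows increase upwards,
-- so row i is "below" row i+1, and "above" means larger row index).
Cell : Set
Cell = ℕ × ℕ

-- A diagram is a finite set of cells, represented by a list of cells;
-- diagrams are compared as sets (see _≈ᴰ_), duplicates are irrelevant.
Diagram : Set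
Diagram = List Cell

ValidDiagram : Diagram → Set
ValidDiagram D = All (λ x → 1 ≤ proj₁ x × 1 ≤ proj₂ x) D

_≈ᴰ_ : Diagram → Diagram → Set
D ≈ᴰ D' = ∀ (x : Cell) → (x ∈ D) ⇔ (x ∈ D')

cellEq : Cell → Cell → Bool
cellEq (a , b) (c , d) = (a ≡ᵇ c) ∧ (b ≡ᵇ d)

mem : Diagram → ℕ → ℕ → Bool
mem D r c = any (cellEq (r , c)) D

remove : Cell → Diagram → Diagram
remove x [] = []
remove x (y ∷ D) = if cellEq x y then remove x D else y ∷ remove x D

maxRow : Diagram → ℕ
maxRow = foldr (λ x m → proj₁ x ⊔ m) 0

maxCol : Diagram → ℕ
maxCol = foldr (λ x m → proj₂ x ⊔ m) 0

-- sum of column indices (termination measure for rectification)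
colSum : Diagram → ℕ
colSum = foldr (λ x m → proj₂ x + m) 0

-- Positions are visited in the given order; at a
-- position, `first` says whether the earlier line (row i, resp. column i)
-- has a cell there, `second` whether the moving line (row i+1, resp.
-- column i+1) does. Cells at the same position are paired; a cell of
-- the second line is paired with an unpaired cell of the first line
-- visited earlier such that everything between them is paired
-- (bracket matching; k counts unpaired first-line cells so far).
unpairedScan : (ℕ → Bool) → (ℕ → Bool) → List ℕ → ℕ → List ℕ
unpairedScan f s [] k = []
unpairedScan f s (p ∷ ps) k with f p | s p
... | true  | true  = unpairedScan f s ps k
... | true  | false = unpairedScan f s ps (suc k)
... | false | false = unpairedScan f s ps k
... | false | true with k
...   | zero   = p ∷ unpairedScan f s ps zero
...   | suc k' = unpairedScan f s ps k'

lastM : List ℕ → Maybe ℕ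
lastM [] = nothing
lastM (x ∷ []) = just x
lastM (x ∷ y ∷ xs) = lastM (y ∷ xs)

vUnpaired : ℕ → Diagram → List ℕ
vUnpaired i D = unpairedScan (mem D i) (mem D (suc i)) (applyUpTo suc (maxCol D)) 0

-- rows of the horizontally unpaired cells of column i+1 (horizontal
-- i-pairing), listed top to bottom
hUnpaired : ℕ → Diagram → List ℕ
hUnpaired i D = unpairedScan (λ r → mem D r i) (λ r → mem D r (suc i))
                  (reverse (applyUpTo suc (maxRow D))) 0

-- ẽ_i : nothing represents 0
e~ : ℕ → Diagram → Maybe Diagram
e~ i D with lastM (vUnpaired i D)
... | nothing = nothing
... | just c  = just ((i , c) ∷ remove (suc i , c) D)

-- Ẽ_i : nothing represents 0
E~ : ℕ → Diagram → Maybe Diagram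
E~ i D with lastM (hUnpaired i D)
... | nothing = nothing
... | just r  = just ((r , i) ∷ remove (r , suc i) D)

firstE : Diagram → List ℕ → Maybe Diagram
firstE D [] = nothing
firstE D (i ∷ is) with E~ i D
... | nothing = firstE D is
... | just D' = just D'

-- rectification with fuel; Ẽ_i(D) = 0 automatically for i ≥ maxCol D,
-- so it suffices to try i = 1 .. maxCol D. Each step strictly decreases
-- colSum, so fuel colSum D + 1 is never exhausted.
rectF : ℕ → Diagram → Diagram
rectF zero D = D
rectF (suc n) D with firstE D (applyUpTo suc (maxCol D))
... | nothing = D
... | just D' = rectF n D'

rect : Diagram → Diagram
rect D = rectF (suc (colSum D)) D

module Submission where

-- For r, i ≥ 1 the operators ẽ_r and Ẽ_i commute in a strong sense:
-- ẽ_r D ≠ 0 implies (Ẽ_i D = 0 ⇔ Ẽ_i (ẽ_r D) = 0), ẽ_r D = 0 implies ẽ_r (Ẽ_i D) = 0, and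
-- when both moves are defined, ẽ_r (Ẽ_i D) = Ẽ_i (ẽ_r D). So rectification chooses the same
-- index i at every step for D and for ẽ_r D, and ẽ_r can be pushed through all the steps.
--
-- The commutation is local. Ẽ_i changes only columns i and i + 1, that is, two consecutive
-- positions of the scan computing the vertical r-pairing. Such a change leaves the last
-- unpaired position of the scan where it is, provided the window passes on the same number of
-- open row-r cells and does not create an unpaired cell; the pairing conditions satisfied by
-- the cell that Ẽ_i moves guarantee exactly this. Dually for ẽ_r and the horizontal
-- i-pairing. When both moved cells lie in the square {r, r + 1} × {i, i + 1}, each operator
-- redirects the other, and both composites move the cell (r + 1, i + 1) to (r, i).

open import Defs
open import Data.Nat using (ℕ; _≤_)
open import Data.Product using (_×_)
open import Data.Maybe using (just; nothing)
open import Relation.Binary.PropositionalEquality using (_≡_; _≢_)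
open import Function.Bundles using (_⇔_)

open import Data.Nat using (zero; suc; _<_; _+_; _∸_; _⊔_; _≡ᵇ_; z≤n; s≤s)
open import Data.Nat.Properties
open import Algebra.Properties.CommutativeSemigroup +-commutativeSemigroup using (x∙yz≈y∙xz)
open import Data.Bool using (Bool; true; false; _∧_; _∨_; not; if_then_else_)
open import Data.Bool.Properties using (T-≡; ¬-not)
open import Data.List using (List; []; _∷_; _++_; foldr; applyUpTo; reverse)
open import Data.List.Properties using (++-assoc; ++-identityʳ; reverse-++)
open import Data.List.Membership.Propositional using (_∈_)
open import Data.List.Membership.Propositional.Properties using (∈-applyUpTo⁻)
open import Data.List.Relation.Unary.All as All using (All; []; _∷_)
open import Data.List.Relation.Binary.Permutation.Propositional using (↭-sym)
open import Data.List.Relation.Binary.Permutation.Propositional.Properties using (All-resp-↭; ↭-reverse)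
open import Data.List.Relation.Unary.Any using (here; there)
open import Data.Maybe using (Maybe; maybe; _<∣>_)
open import Data.Maybe.Properties using (just-injective)
open import Data.Maybe.Relation.Binary.Pointwise as Pointwise using (Pointwise; just; nothing)
open import Data.Product using (∃-syntax; _,_; proj₁; proj₂)
open import Data.Sum using (_⊎_; inj₁; inj₂)
open import Data.Empty using (⊥; ⊥-elim)
open import Function.Bundles using (mk⇔; Equivalence)
open import Function using (case_of_)
open import Relation.Nullary using (yes; no)
open import Relation.Binary.PropositionalEquality
  using (refl; sym; trans; cong; cong₂; subst₂; ≢-sym; module ≡-Reasoning)

false≢true : false ≢ true
false≢true ()

n≢1+n : ∀ {n} → n ≢ suc n
n≢1+n = ≢-sym 1+n≢n

pair-cases : ∀ a b → (a ≡ b ⊎ a ≡ suc b) ⊎ (a ≢ b × a ≢ suc b)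
pair-cases a b with a ≟ b | a ≟ suc b
... | yes a≡b | _        = inj₁ (inj₁ a≡b)
... | no _    | yes a≡sb = inj₁ (inj₂ a≡sb)
... | no a≢b  | no a≢sb  = inj₂ (a≢b , a≢sb)

≡ᵇ-true⇒≡ : ∀ m n → (m ≡ᵇ n) ≡ true → m ≡ n
≡ᵇ-true⇒≡ m n e = ≡ᵇ⇒≡ m n (Equivalence.from T-≡ e)

≡ᵇ-refl : ∀ n → (n ≡ᵇ n) ≡ true
≡ᵇ-refl n = Equivalence.to T-≡ (≡⇒≡ᵇ n n refl)

cellEq-refl : ∀ x → cellEq x x ≡ true
cellEq-refl (a , b) rewrite ≡ᵇ-refl a | ≡ᵇ-refl b = refl

cellEq⇒≡ : ∀ x y → cellEq x y ≡ true → x ≡ y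
cellEq⇒≡ (a , b) (c , d) with a ≡ᵇ c in ac | b ≡ᵇ d in bd
... | true  | true  = λ _ → cong₂ _,_ (≡ᵇ-true⇒≡ a c ac) (≡ᵇ-true⇒≡ b d bd)
... | true  | false = λ ()
... | false | _     = λ ()

row≢ : ∀ {a b c d : ℕ} → a ≢ c → (a , b) ≢ (c , d)
row≢ a≢c refl = a≢c refl

col≢ : ∀ {a b c d : ℕ} → b ≢ d → (a , b) ≢ (c , d)
col≢ b≢d refl = b≢d refl

cellEq-false⇒≢ : ∀ {x y} → cellEq x y ≡ false → x ≢ y
cellEq-false⇒≢ {x} e refl = false≢true (trans (sym e) (cellEq-refl x))

≢⇒cellEq-false : ∀ {x y} → x ≢ y → cellEq x y ≡ false
≢⇒cellEq-false {x} {y} x≢y with cellEq x y in e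
... | true  = ⊥-elim (x≢y (cellEq⇒≡ x y e))
... | false = refl

∈⇒mem : ∀ {D x} → x ∈ D → mem D (proj₁ x) (proj₂ x) ≡ true
∈⇒mem {x = x} (here refl) rewrite cellEq-refl x = refl
∈⇒mem {y ∷ D} {x} (there x∈D) rewrite ∈⇒mem {D} x∈D with cellEq x y
... | true  = refl
... | false = refl

mem⇒∈ : ∀ D u v → mem D u v ≡ true → (u , v) ∈ D
mem⇒∈ (y ∷ D) u v e with cellEq (u , v) y in e₁
... | true  = here (cellEq⇒≡ _ _ e₁)
... | false = there (mem⇒∈ D u v e)

mem-remove : ∀ D y u v → mem (remove y D) u v ≡ not (cellEq (u , v) y) ∧ mem D u v
mem-remove [] y u v with cellEq (u , v) y
... | true  = refl
... | false = refl
mem-remove (z ∷ D) y u v with cellEq y z in y≟z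
... | true rewrite mem-remove D y u v | cellEq⇒≡ y z y≟z with cellEq (u , v) z
...   | true  = refl
...   | false = refl
mem-remove (z ∷ D) y u v | false rewrite mem-remove D y u v with cellEq (u , v) z in uv≟z
...   | false = refl
...   | true = cong (λ b → not b ∧ true) (sym (≢⇒cellEq-false uv≢y))
  where uv≢y : (u , v) ≢ y
        uv≢y uv≡y = cellEq-false⇒≢ y≟z (trans (sym uv≡y) (cellEq⇒≡ _ _ uv≟z))

move : Cell → Cell → Diagram → Diagram
move from to D = to ∷ remove from D

mem-move : ∀ D y x u v →
  mem (move y x D) u v ≡ cellEq (u , v) x ∨ (not (cellEq (u , v) y) ∧ mem D u v)
mem-move D y x u v = cong (cellEq (u , v) x ∨_) (mem-remove D y u v)

mem-move-target : ∀ D y x → mem (move y x D) (proj₁ x) (proj₂ x) ≡ true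
mem-move-target D y x rewrite mem-move D y x (proj₁ x) (proj₂ x) | cellEq-refl x = refl

mem-move-source : ∀ D {y x} → y ≢ x → mem (move y x D) (proj₁ y) (proj₂ y) ≡ false
mem-move-source D {y} {x} y≢x
  rewrite mem-move D y x (proj₁ y) (proj₂ y) | ≢⇒cellEq-false y≢x | cellEq-refl y = refl

mem-move-other : ∀ D {y x} u v → (u , v) ≢ x → (u , v) ≢ y → mem (move y x D) u v ≡ mem D u v
mem-move-other D {y} {x} u v ≢x ≢y
  rewrite mem-move D y x u v | ≢⇒cellEq-false ≢x | ≢⇒cellEq-false ≢y = refl

infix 4 _≐_

_≐_ : Diagram → Diagram → Set
D ≐ D' = ∀ u v → mem D u v ≡ mem D' u v

≐-sym : ∀ {D D'} → D ≐ D' → D' ≐ D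
≐-sym D≐D' u v = sym (D≐D' u v)

≐-trans : ∀ {D D' D''} → D ≐ D' → D' ≐ D'' → D ≐ D''
≐-trans D≐D' D'≐D'' u v = trans (D≐D' u v) (D'≐D'' u v)

≐⇒≈ᴰ : ∀ {D D'} → D ≐ D' → D ≈ᴰ D'
≐⇒≈ᴰ {D} {D'} D≐D' (u , v) =
  mk⇔ (λ x∈D → mem⇒∈ D' u v (trans (sym (D≐D' u v)) (∈⇒mem x∈D)))
      (λ x∈D' → mem⇒∈ D u v (trans (D≐D' u v) (∈⇒mem x∈D')))

move-cong : ∀ {D D'} y x → D ≐ D' → move y x D ≐ move y x D'
move-cong {D} {D'} y x D≐D' u v rewrite mem-move D y x u v | mem-move D' y x u v | D≐D' u v = refl

cellEq-true⇒cellEq-false : ∀ pt {x y} → x ≢ y → cellEq pt x ≡ true → cellEq pt y ≡ false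
cellEq-true⇒cellEq-false pt {x} {y} x≢y e =
  ≢⇒cellEq-false {pt} {y} (λ pt≡y → x≢y (trans (sym (cellEq⇒≡ pt x e)) pt≡y))

cellEq-true⇒mem : ∀ D u v x {b} → mem D (proj₁ x) (proj₂ x) ≡ b → cellEq (u , v) x ≡ true →
  mem D u v ≡ b
cellEq-true⇒mem D u v x mem-x e =
  trans (cong (λ w → mem D (proj₁ w) (proj₂ w)) (cellEq⇒≡ (u , v) x e)) mem-x

move-comm : ∀ D {y₁ x₁ y₂ x₂} → x₁ ≢ y₂ → x₂ ≢ y₁ →
  move y₁ x₁ (move y₂ x₂ D) ≐ move y₂ x₂ (move y₁ x₁ D)
move-comm D {y₁} {x₁} {y₂} {x₂} x₁≢y₂ x₂≢y₁ u v
  rewrite mem-move (move y₂ x₂ D) y₁ x₁ u v | mem-move D y₂ x₂ u v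
        | mem-move (move y₁ x₁ D) y₂ x₂ u v | mem-move D y₁ x₁ u v
  = interchange (cellEq pt x₁) (cellEq pt y₁) (cellEq pt x₂) (cellEq pt y₂) (mem D u v)
      (cellEq-true⇒cellEq-false pt x₁≢y₂) (cellEq-true⇒cellEq-false pt x₂≢y₁)
  where
  pt = (u , v)
  interchange : ∀ X₁ Y₁ X₂ Y₂ m →
    (X₁ ≡ true → Y₂ ≡ false) → (X₂ ≡ true → Y₁ ≡ false) →
    X₁ ∨ (not Y₁ ∧ (X₂ ∨ (not Y₂ ∧ m))) ≡ X₂ ∨ (not Y₂ ∧ (X₁ ∨ (not Y₁ ∧ m)))
  interchange true  _     _     true  _ h _ = ⊥-elim (false≢true (sym (h refl)))
  interchange true  _     true  false _ _ _ = refl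
  interchange true  _     false false _ _ _ = refl
  interchange false true  true  _     _ _ h = ⊥-elim (false≢true (sym (h refl)))
  interchange false false true  _     _ _ _ = refl
  interchange false true  false true  _ _ _ = refl
  interchange false true  false false _ _ _ = refl
  interchange false false false _     _ _ _ = refl

move-via-occupied : ∀ D {z y x} → mem D (proj₁ y) (proj₂ y) ≡ true →
  x ≢ y → y ≢ z → x ≢ z →
  move z y (move y x D) ≐ move z x D
move-via-occupied D {z} {y} {x} y∈D x≢y y≢z x≢z u v
  rewrite mem-move (move y x D) z y u v | mem-move D y x u v | mem-move D z x u v
  = via (cellEq pt x) (cellEq pt y) (cellEq pt z) (mem D u v)
      (cellEq-true⇒cellEq-false pt x≢y) (cellEq-true⇒cellEq-false pt x≢z)
      (cellEq-true⇒cellEq-false pt y≢z) (cellEq-true⇒mem D u v y y∈D)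
  where
  pt = (u , v)
  via : ∀ X Y Z m →
    (X ≡ true → Y ≡ false) → (X ≡ true → Z ≡ false) → (Y ≡ true → Z ≡ false) →
    (Y ≡ true → m ≡ true) → Y ∨ (not Z ∧ (X ∨ (not Y ∧ m))) ≡ X ∨ (not Z ∧ m)
  via true  true  _     _     h _ _ _ = ⊥-elim (false≢true (sym (h refl)))
  via true  false true  _     _ h _ _ = ⊥-elim (false≢true (sym (h refl)))
  via true  false false _     _ _ _ _ = refl
  via false true  true  _     _ _ h _ = ⊥-elim (false≢true (sym (h refl)))
  via false true  false false _ _ _ h = ⊥-elim (false≢true (h refl))
  via false true  false true  _ _ _ _ = refl
  via false false _     _     _ _ _ _ = refl

move-via-empty : ∀ D {z y x} → mem D (proj₁ y) (proj₂ y) ≡ false → y ≢ z →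
  move y x (move z y D) ≐ move z x D
move-via-empty D {z} {y} {x} y∉D y≢z u v
  rewrite mem-move (move z y D) y x u v | mem-move D z y u v | mem-move D z x u v
  = via (cellEq pt x) (cellEq pt y) (cellEq pt z) (mem D u v)
      (cellEq-true⇒cellEq-false pt y≢z) (cellEq-true⇒mem D u v y y∉D)
  where
  pt = (u , v)
  via : ∀ X Y Z m → (Y ≡ true → Z ≡ false) → (Y ≡ true → m ≡ false) →
    X ∨ (not Y ∧ (Y ∨ (not Z ∧ m))) ≡ X ∨ (not Z ∧ m)
  via true  _     _     _     _ _ = refl
  via false true  true  _     h _ = ⊥-elim (false≢true (sym (h refl)))
  via false true  false true  _ h = ⊥-elim (false≢true (sym (h refl)))
  via false true  false false _ _ = refl
  via false false _     _     _ _ = refl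

maxOf : (Cell → ℕ) → Diagram → ℕ
maxOf π = foldr (λ x m → π x ⊔ m) 0

∈⇒≤maxOf : ∀ π {X x} → x ∈ X → π x ≤ maxOf π X
∈⇒≤maxOf π (here refl) = m≤m⊔n _ _
∈⇒≤maxOf π {z ∷ X} (there x∈X) = m≤n⇒m≤o⊔n (π z) (∈⇒≤maxOf π x∈X)

maxOf-remove : ∀ π y X → maxOf π (remove y X) ≤ maxOf π X
maxOf-remove π y [] = z≤n
maxOf-remove π y (z ∷ X) with cellEq y z
... | true  = m≤n⇒m≤o⊔n (π z) (maxOf-remove π y X)
... | false = ⊔-monoʳ-≤ (π z) (maxOf-remove π y X)

maxOf-move : ∀ π y x X → π x ≤ maxOf π X → maxOf π (move y x X) ≤ maxOf π X
maxOf-move π y x X πx≤ = ⊔-lub πx≤ (maxOf-remove π y X)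

mem⇒≤maxCol : ∀ X u v → mem X u v ≡ true → v ≤ maxCol X
mem⇒≤maxCol X u v e = ∈⇒≤maxOf proj₂ (mem⇒∈ X u v e)

mem⇒≤maxRow : ∀ X u v → mem X u v ≡ true → u ≤ maxRow X
mem⇒≤maxRow X u v e = ∈⇒≤maxOf proj₁ (mem⇒∈ X u v e)

>maxCol⇒mem-false : ∀ X u v → maxCol X < v → mem X u v ≡ false
>maxCol⇒mem-false X u v lt with mem X u v in e
... | false = refl
... | true  = ⊥-elim (<⇒≱ lt (mem⇒≤maxCol X u v e))

>maxRow⇒mem-false : ∀ X u v → maxRow X < u → mem X u v ≡ false
>maxRow⇒mem-false X u v lt with mem X u v in e
... | false = refl
... | true  = ⊥-elim (<⇒≱ lt (mem⇒≤maxRow X u v e))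

colSum-remove-≤ : ∀ y X → colSum (remove y X) ≤ colSum X
colSum-remove-≤ y [] = z≤n
colSum-remove-≤ y (z ∷ X) with cellEq y z
... | true  = ≤-trans (colSum-remove-≤ y X) (m≤n+m _ _)
... | false = +-monoʳ-≤ (proj₂ z) (colSum-remove-≤ y X)

colSum-remove : ∀ {y} X → y ∈ X → proj₂ y + colSum (remove y X) ≤ colSum X
colSum-remove {y} (z ∷ X) y∈ with cellEq y z in y≟z
... | true rewrite cellEq⇒≡ y z y≟z = +-monoʳ-≤ (proj₂ z) (colSum-remove-≤ z X)
colSum-remove {y} (z ∷ X) (here refl)  | false = ⊥-elim (cellEq-false⇒≢ {y} {y} y≟z refl)
colSum-remove {y} (z ∷ X) (there y∈X) | false = begin
  proj₂ y + (proj₂ z + colSum (remove y X)) ≡⟨ x∙yz≈y∙xz (proj₂ y) (proj₂ z) _ ⟩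
  proj₂ z + (proj₂ y + colSum (remove y X)) ≤⟨ +-monoʳ-≤ (proj₂ z) (colSum-remove X y∈X) ⟩
  proj₂ z + colSum X                        ∎
  where open ≤-Reasoning

-- One step of unpairedScan at a position with first-line and second-line cells b₁, b₂, where k
-- first-line cells are still open: is the position output, and how many cells are open after it.
isUnpaired : Bool → Bool → ℕ → Bool
isUnpaired false true  zero    = true
isUnpaired false true  (suc k) = false
isUnpaired true  _     k       = false
isUnpaired false false k       = false

stepCount : Bool → Bool → ℕ → ℕ
stepCount true  true  k       = k
stepCount true  false k       = suc k
stepCount false false k       = k
stepCount false true  zero    = zero
stepCount false true  (suc k) = k

isUnpaired⇒ : ∀ b₁ b₂ k → isUnpaired b₁ b₂ k ≡ true → b₁ ≡ false × b₂ ≡ true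
isUnpaired⇒ false true zero _ = refl , refl

scanCount : (ℕ → Bool) → (ℕ → Bool) → List ℕ → ℕ → ℕ
scanCount f s []       k = k
scanCount f s (p ∷ ps) k = scanCount f s ps (stepCount (f p) (s p) k)

module _ (f s : ℕ → Bool) where

  unpairedScan-∷ : ∀ p ps k → unpairedScan f s (p ∷ ps) k ≡
    (if isUnpaired (f p) (s p) k
     then p ∷ unpairedScan f s ps (stepCount (f p) (s p) k)
     else unpairedScan f s ps (stepCount (f p) (s p) k))
  unpairedScan-∷ p ps k with f p | s p
  ... | true  | true  = refl
  ... | true  | false = refl
  ... | false | false = refl
  ... | false | true with k
  ...   | zero  = refl
  ...   | suc _ = refl

  unpairedScan-++ : ∀ xs ys k →
    unpairedScan f s (xs ++ ys) k ≡ unpairedScan f s xs k ++ unpairedScan f s ys (scanCount f s xs k)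
  unpairedScan-++ []       ys k = refl
  unpairedScan-++ (p ∷ xs) ys k
    rewrite unpairedScan-∷ p (xs ++ ys) k | unpairedScan-∷ p xs k
    with isUnpaired (f p) (s p) k
  ... | true  = cong (p ∷_) (unpairedScan-++ xs ys _)
  ... | false = unpairedScan-++ xs ys _

  unpairedScan-All : ∀ {P : ℕ → Set} ps k → All P ps → All P (unpairedScan f s ps k)
  unpairedScan-All []       k []         = []
  unpairedScan-All (p ∷ ps) k (Pp ∷ Pps)
    rewrite unpairedScan-∷ p ps k with isUnpaired (f p) (s p) k
  ... | true  = Pp ∷ unpairedScan-All ps _ Pps
  ... | false = unpairedScan-All ps _ Pps

  unpairedScan-unpaired : ∀ ps k → All (λ p → f p ≡ false × s p ≡ true) (unpairedScan f s ps k)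
  unpairedScan-unpaired []       k = []
  unpairedScan-unpaired (p ∷ ps) k
    rewrite unpairedScan-∷ p ps k with isUnpaired (f p) (s p) k in e
  ... | true  = isUnpaired⇒ (f p) (s p) k e ∷ unpairedScan-unpaired ps _
  ... | false = unpairedScan-unpaired ps _

  unpairedScan-blank : ∀ ps k → All (λ p → f p ≡ false × s p ≡ false) ps →
    unpairedScan f s ps k ≡ [] × scanCount f s ps k ≡ k
  unpairedScan-blank []       k []                 = refl , refl
  unpairedScan-blank (p ∷ ps) k ((fp , sp) ∷ blank)
    rewrite unpairedScan-∷ p ps k | fp | sp = unpairedScan-blank ps k blank

Agree : (ℕ → Bool) → (ℕ → Bool) → (ℕ → Bool) → (ℕ → Bool) → ℕ → Set
Agree f s f' s' x = f x ≡ f' x × s x ≡ s' x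

unpairedScan-cong : ∀ {f s f' s'} ps k → All (Agree f s f' s') ps →
  unpairedScan f s ps k ≡ unpairedScan f' s' ps k × scanCount f s ps k ≡ scanCount f' s' ps k
unpairedScan-cong []       k []                 = refl , refl
unpairedScan-cong {f} {s} {f'} {s'} (p ∷ ps) k ((fp , sp) ∷ agree)
  rewrite unpairedScan-∷ f s p ps k | unpairedScan-∷ f' s' p ps k | fp | sp
  with isUnpaired (f' p) (s' p) k | unpairedScan-cong ps (stepCount (f' p) (s' p) k) agree
... | true  | same , sameCount = cong (p ∷_) same , sameCount
... | false | same , sameCount = same , sameCount

<∣>-assoc : ∀ (a b c : Maybe ℕ) → (a <∣> b) <∣> c ≡ a <∣> (b <∣> c)
<∣>-assoc (just _) b c = refl
<∣>-assoc nothing  b c = refl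

lastM-∷ : ∀ x xs → lastM (x ∷ xs) ≡ lastM xs <∣> just x
lastM-∷ x []       = refl
lastM-∷ x (y ∷ xs) rewrite lastM-∷ y xs with lastM xs
... | just _  = refl
... | nothing = refl

lastM-++ : ∀ xs ys → lastM (xs ++ ys) ≡ lastM ys <∣> lastM xs
lastM-++ []       ys with lastM ys
... | just _  = refl
... | nothing = refl
lastM-++ (x ∷ xs) ys = begin
  lastM (x ∷ xs ++ ys)                     ≡⟨ lastM-∷ x (xs ++ ys) ⟩
  lastM (xs ++ ys) <∣> just x              ≡⟨ cong (_<∣> just x) (lastM-++ xs ys) ⟩
  (lastM ys <∣> lastM xs) <∣> just x       ≡⟨ <∣>-assoc (lastM ys) _ _ ⟩
  lastM ys <∣> (lastM xs <∣> just x)       ≡⟨ cong (lastM ys <∣>_) (sym (lastM-∷ x xs)) ⟩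
  lastM ys <∣> lastM (x ∷ xs)              ∎
  where open ≡-Reasoning

lastM-All : ∀ {P : ℕ → Set} xs {z} → All P xs → lastM xs ≡ just z → P z
lastM-All (x ∷ [])     (Px ∷ [])  refl = Px
lastM-All (x ∷ y ∷ xs) (_ ∷ Pxs) e    = lastM-All (y ∷ xs) Pxs e

-- Two consecutive positions of a scan. A move of the other operator changes a scan only in
-- such a window.
record Window : Set where
  constructor window
  field first₀ second₀ first₁ second₁ : Bool

windowAt : (ℕ → Bool) → (ℕ → Bool) → ℕ → ℕ → Window
windowAt f s p q = window (f p) (s p) (f q) (s q)

windowOut : Window → ℕ → ℕ → ℕ → List ℕ
windowOut (window f₀ s₀ f₁ s₁) p q k =
  (if isUnpaired f₀ s₀ k then p ∷ [] else []) ++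
  (if isUnpaired f₁ s₁ (stepCount f₀ s₀ k) then q ∷ [] else [])

windowCount : Window → ℕ → ℕ
windowCount (window f₀ s₀ f₁ s₁) k = stepCount f₁ s₁ (stepCount f₀ s₀ k)

windowOut-⊆ : ∀ W p q k → All (λ y → y ≡ p ⊎ y ≡ q) (windowOut W p q k)
windowOut-⊆ (window f₀ s₀ f₁ s₁) p q k
  with isUnpaired f₀ s₀ k | isUnpaired f₁ s₁ (stepCount f₀ s₀ k)
... | true  | true  = inj₁ refl ∷ inj₂ refl ∷ []
... | true  | false = inj₁ refl ∷ []
... | false | true  = inj₂ refl ∷ []
... | false | false = []

module _ (f s : ℕ → Bool) where

  unpairedScan-window : ∀ p q k → unpairedScan f s (p ∷ q ∷ []) k ≡ windowOut (windowAt f s p q) p q k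
  unpairedScan-window p q k
    rewrite unpairedScan-∷ f s p (q ∷ []) k | unpairedScan-∷ f s q [] (stepCount (f p) (s p) k)
    with isUnpaired (f p) (s p) k | isUnpaired (f q) (s q) (stepCount (f p) (s p) k)
  ... | true  | true  = refl
  ... | true  | false = refl
  ... | false | true  = refl
  ... | false | false = refl

  lastM-unpairedScan-split : ∀ us p q vs k →
    lastM (unpairedScan f s (us ++ p ∷ q ∷ vs) k) ≡
      lastM (unpairedScan f s vs (windowCount (windowAt f s p q) (scanCount f s us k)))
      <∣> lastM (windowOut (windowAt f s p q) p q (scanCount f s us k))
      <∣> lastM (unpairedScan f s us k)
  lastM-unpairedScan-split us p q vs k = begin
    lastM (unpairedScan f s (us ++ p ∷ q ∷ vs) k)
      ≡⟨ cong lastM (unpairedScan-++ f s us (p ∷ q ∷ vs) k) ⟩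
    lastM (unpairedScan f s us k ++ unpairedScan f s ((p ∷ q ∷ []) ++ vs) k₁)
      ≡⟨ lastM-++ (unpairedScan f s us k) _ ⟩
    lastM (unpairedScan f s ((p ∷ q ∷ []) ++ vs) k₁) <∣> A
      ≡⟨ cong (λ xs → lastM xs <∣> A) (unpairedScan-++ f s (p ∷ q ∷ []) vs k₁) ⟩
    lastM (unpairedScan f s (p ∷ q ∷ []) k₁ ++ unpairedScan f s vs k₂) <∣> A
      ≡⟨ cong (_<∣> A) (lastM-++ (unpairedScan f s (p ∷ q ∷ []) k₁) _) ⟩
    (lastM (unpairedScan f s vs k₂) <∣> lastM (unpairedScan f s (p ∷ q ∷ []) k₁)) <∣> A
      ≡⟨ <∣>-assoc (lastM (unpairedScan f s vs k₂)) _ A ⟩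
    lastM (unpairedScan f s vs k₂) <∣> lastM (unpairedScan f s (p ∷ q ∷ []) k₁) <∣> A
      ≡⟨ cong (λ xs → lastM (unpairedScan f s vs k₂) <∣> lastM xs <∣> A)
              (unpairedScan-window p q k₁) ⟩
    lastM (unpairedScan f s vs k₂) <∣> lastM (windowOut (windowAt f s p q) p q k₁) <∣> A ∎
    where
    open ≡-Reasoning
    k₁ = scanCount f s us k
    k₂ = windowCount (windowAt f s p q) k₁
    A = lastM (unpairedScan f s us k)

<∣>-silent : ∀ (V P P' A : Maybe ℕ) → (P ≡ nothing → P' ≡ nothing) →
  V <∣> P <∣> A ≡ nothing → V <∣> P' <∣> A ≡ nothing
<∣>-silent nothing nothing P' A silent e rewrite silent refl = e

<∣>-stable : ∀ (V P P' A : Maybe ℕ) {a} → (P ≡ nothing → P' ≡ nothing) → P ≢ just a →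
  V <∣> P <∣> A ≡ just a → V <∣> P' <∣> A ≡ just a
<∣>-stable (just _) P P' A silent P≢a e = e
<∣>-stable nothing (just _) P' A silent P≢a e = ⊥-elim (P≢a e)
<∣>-stable nothing nothing P' A silent P≢a e rewrite silent refl = e

<∣>-retarget : ∀ (V P P' A : Maybe ℕ) {x y} → V ≢ just x → A ≢ just x →
  (P ≡ just x → P' ≡ just y) →
  V <∣> P <∣> A ≡ just x → V <∣> P' <∣> A ≡ just y
<∣>-retarget (just _) P P' A V≢x A≢x retarget e = ⊥-elim (V≢x e)
<∣>-retarget nothing (just _) P' A V≢x A≢x retarget e rewrite retarget e = refl
<∣>-retarget nothing nothing P' A V≢x A≢x retarget e = ⊥-elim (A≢x e)

<∣>-middle : ∀ (V P A : Maybe ℕ) {a} → V ≢ just a → A ≢ just a →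
  V <∣> P <∣> A ≡ just a → P ≡ just a
<∣>-middle (just _) P A V≢a A≢a e = ⊥-elim (V≢a e)
<∣>-middle nothing (just _) A V≢a A≢a e = e
<∣>-middle nothing nothing  A V≢a A≢a e = ⊥-elim (A≢a e)

lastM-unpairedScan-avoids : ∀ f s ps k {x} → All (_≢ x) ps → lastM (unpairedScan f s ps k) ≢ just x
lastM-unpairedScan-avoids f s ps k avoid e = lastM-All _ (unpairedScan-All f s ps k avoid) e refl

Replaceable : Window → Window → Set
Replaceable W W' = ∀ k → windowCount W k ≡ windowCount W' k ×
  (∀ p q → lastM (windowOut W p q k) ≡ nothing → lastM (windowOut W' p q k) ≡ nothing)

Retargets : Window → Window → ℕ → ℕ → ℕ → ℕ → Set
Retargets W W' p q x y = ∀ k → windowCount W k ≡ windowCount W' k ×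
  (lastM (windowOut W p q k) ≡ just x → lastM (windowOut W' p q k) ≡ just y)

record Splitting (ps : List ℕ) (p q : ℕ) : Set where
  field
    before after  : List ℕ
    splits        : ps ≡ before ++ p ∷ q ∷ after
    before-avoids : All (λ x → x ≢ p × x ≢ q) before
    after-avoids  : All (λ x → x ≢ p × x ≢ q) after

module WindowChange (f s f' s' : ℕ → Bool) {ps p q} (sp : Splitting ps p q)
  (agree : ∀ x → x ≢ p → x ≢ q → Agree f s f' s' x) where

  open Splitting sp renaming (before to us; after to vs; before-avoids to us-avoid; after-avoids to vs-avoid)

  private
    W  = windowAt f s p q
    W' = windowAt f' s' p q
    k₁ = scanCount f s us 0
    V  = lastM (unpairedScan f s vs (windowCount W k₁))
    P  = lastM (windowOut W p q k₁)
    P' = lastM (windowOut W' p q k₁)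
    A  = lastM (unpairedScan f s us 0)

    agreeAll : ∀ xs → All (λ x → x ≢ p × x ≢ q) xs → All (Agree f s f' s') xs
    agreeAll xs = All.map (λ (≢p , ≢q) → agree _ ≢p ≢q)

    old-split : lastM (unpairedScan f s ps 0) ≡ V <∣> P <∣> A
    old-split rewrite splits = lastM-unpairedScan-split f s us p q vs 0

    new-split : (∀ k → windowCount W k ≡ windowCount W' k) →
      lastM (unpairedScan f' s' ps 0) ≡ V <∣> P' <∣> A
    new-split sameCount rewrite splits
      | proj₁ (unpairedScan-cong us 0 (agreeAll us us-avoid))
      | proj₂ (unpairedScan-cong {f} {s} {f'} {s'} us 0 (agreeAll us us-avoid))
      | lastM-unpairedScan-split f' s' us p q vs 0
      | sym (sameCount (scanCount f' s' us 0))
      | proj₁ (unpairedScan-cong {f} {s} {f'} {s'} vs (windowCount W (scanCount f' s' us 0))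
                                 (agreeAll vs vs-avoid))
      = refl

    avoid : ∀ {x} xs → (x ≡ p ⊎ x ≡ q) → All (λ z → z ≢ p × z ≢ q) xs → All (_≢ x) xs
    avoid xs (inj₁ refl) = All.map proj₁
    avoid xs (inj₂ refl) = All.map proj₂

  silent-preserved : Replaceable W W' →
    lastM (unpairedScan f s ps 0) ≡ nothing → lastM (unpairedScan f' s' ps 0) ≡ nothing
  silent-preserved replace e =
    trans (new-split (λ k → proj₁ (replace k)))
          (<∣>-silent V P P' A (proj₂ (replace k₁) p q) (trans (sym old-split) e))

  last-preserved : Replaceable W W' → ∀ {a} → p ≢ a → q ≢ a →
    lastM (unpairedScan f s ps 0) ≡ just a → lastM (unpairedScan f' s' ps 0) ≡ just a
  last-preserved replace p≢a q≢a e =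
    trans (new-split (λ k → proj₁ (replace k)))
          (<∣>-stable V P P' A (proj₂ (replace k₁) p q) P≢a (trans (sym old-split) e))
    where
    P≢a : P ≢ just _
    P≢a P≡a with lastM-All _ (windowOut-⊆ W p q k₁) P≡a
    ... | inj₁ refl = p≢a refl
    ... | inj₂ refl = q≢a refl

  last-retargeted : ∀ {x y} → (x ≡ p ⊎ x ≡ q) → Retargets W W' p q x y →
    lastM (unpairedScan f s ps 0) ≡ just x → lastM (unpairedScan f' s' ps 0) ≡ just y
  last-retargeted x∈pq retarget e =
    trans (new-split (λ k → proj₁ (retarget k)))
          (<∣>-retarget V P P' A (lastM-unpairedScan-avoids f s vs _ (avoid vs x∈pq vs-avoid))
                            (lastM-unpairedScan-avoids f s us 0 (avoid us x∈pq us-avoid))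
                            (proj₂ (retarget k₁)) (trans (sym old-split) e))

windowOut-after-open : ∀ f₁ s₁ p q k → lastM (windowOut (window true false f₁ s₁) p q k) ≡ nothing
windowOut-after-open true  s₁    p q k = refl
windowOut-after-open false true  p q k = refl
windowOut-after-open false false p q k = refl

windowOut-last-unpaired : ∀ f₀ s₀ p q k {z} →
  lastM (windowOut (window f₀ s₀ false true) p q k) ≡ just z → z ≡ q
windowOut-last-unpaired true  true  p q zero          refl = refl
windowOut-last-unpaired false false p q zero          refl = refl
windowOut-last-unpaired false true  p q zero          refl = refl
windowOut-last-unpaired false true  p q (suc zero)    refl = refl
windowOut-last-unpaired true  true  p q (suc k)       ()
windowOut-last-unpaired true  false p q k             ()
windowOut-last-unpaired false false p q (suc k)       ()
windowOut-last-unpaired false true  p q (suc (suc k)) ()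

module _ (f s : ℕ → Bool) {ps : List ℕ} where

  private
    window-emits-last : ∀ {x y a} (sp : Splitting ps x y) → (∀ {z} → z ≢ x × z ≢ y → z ≢ a) →
      lastM (unpairedScan f s ps 0) ≡ just a →
      lastM (windowOut (windowAt f s x y) x y (scanCount f s (Splitting.before sp) 0)) ≡ just a
    window-emits-last sp ≢a e = <∣>-middle _ _ _
      (lastM-unpairedScan-avoids f s after _ (All.map ≢a after-avoids))
      (lastM-unpairedScan-avoids f s before 0 (All.map ≢a before-avoids))
      (trans (sym (lastM-unpairedScan-split f s before _ _ after 0))
             (trans (cong (λ xs → lastM (unpairedScan f s xs 0)) (sym splits)) e))
      where open Splitting sp

  lastUnpaired-prev : ∀ {x a} → Splitting ps x a →
    lastM (unpairedScan f s ps 0) ≡ just a → f x ≡ true → s x ≡ false → ⊥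
  lastUnpaired-prev {x} {a} sp e fx sx with window-emits-last sp proj₂ e
  ... | emits rewrite fx | sx with () ← trans (sym emits) (windowOut-after-open (f a) (s a) x a _)

  lastUnpaired-next : ∀ {a y} → Splitting ps a y → y ≢ a →
    lastM (unpairedScan f s ps 0) ≡ just a → f y ≡ false → s y ≡ true → ⊥
  lastUnpaired-next {a} {y} sp y≢a e fy sy with window-emits-last sp proj₁ e
  ... | emits rewrite fy | sy = y≢a (sym (windowOut-last-unpaired (f a) (s a) a y _ emits))

shift-first-earlier : ∀ x y → (x ≡ true → y ≡ false → ⊥) →
  Replaceable (window false x true y) (window true x false y)
shift-first-earlier true  true  _ zero    = refl , λ _ _ ()
shift-first-earlier true  true  _ (suc k) = refl , λ _ _ _ → refl
shift-first-earlier true  false h k       = ⊥-elim (h refl refl)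
shift-first-earlier false true  _ zero    = refl , λ _ _ _ → refl
shift-first-earlier false true  _ (suc k) = refl , λ _ _ _ → refl
shift-first-earlier false false _ k       = refl , λ _ _ _ → refl

shift-second-earlier : ∀ x y → (x ≡ false → y ≡ true → ⊥) →
  Replaceable (window x false y true) (window x true y false)
shift-second-earlier true  true  _ k       = refl , λ _ _ _ → refl
shift-second-earlier true  false _ zero    = refl , λ _ _ _ → refl
shift-second-earlier true  false _ (suc k) = refl , λ _ _ _ → refl
shift-second-earlier false true  h k       = ⊥-elim (h refl refl)
shift-second-earlier false false _ zero    = refl , λ _ _ ()
shift-second-earlier false false _ (suc k) = refl , λ _ _ _ → refl

shift-first-later : ∀ x y → (x ≡ true → y ≡ false → ⊥) →
  Replaceable (window true x false y) (window false x true y)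
shift-first-later true  true  _ zero    = refl , λ _ _ ()
shift-first-later true  true  _ (suc k) = refl , λ _ _ _ → refl
shift-first-later true  false h k       = ⊥-elim (h refl refl)
shift-first-later false true  _ zero    = refl , λ _ _ _ → refl
shift-first-later false true  _ (suc k) = refl , λ _ _ _ → refl
shift-first-later false false _ k       = refl , λ _ _ _ → refl

shift-second-later : ∀ x y → (x ≡ false → y ≡ true → ⊥) →
  Replaceable (window x true y false) (window x false y true)
shift-second-later true  true  _ k       = refl , λ _ _ _ → refl
shift-second-later true  false _ zero    = refl , λ _ _ _ → refl
shift-second-later true  false _ (suc k) = refl , λ _ _ _ → refl
shift-second-later false true  h k       = ⊥-elim (h refl refl)
shift-second-later false false _ zero    = refl , λ _ _ ()
shift-second-later false false _ (suc k) = refl , λ _ _ _ → refl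

retarget-first-earlier : ∀ p q →
  Retargets (window false true true true) (window true true false true) p q p q
retarget-first-earlier p q zero    = refl , λ _ → refl
retarget-first-earlier p q (suc k) = refl , λ ()

retarget-first-later : ∀ p q →
  Retargets (window true true false true) (window false true true true) p q q p
retarget-first-later p q zero    = refl , λ _ → refl
retarget-first-later p q (suc k) = refl , λ ()

retarget-second-earlier : ∀ p q →
  Retargets (window false false false true) (window false true false false) p q q p
retarget-second-earlier p q zero    = refl , λ _ → refl
retarget-second-earlier p q (suc k) = refl , λ ()

retarget-second-later : ∀ p q →
  Retargets (window false true false false) (window false false false true) p q p q
retarget-second-later p q zero    = refl , λ _ → refl
retarget-second-later p q (suc k) = refl , λ ()

range : ℕ → ℕ → List ℕ
range a zero    = []
range a (suc n) = a ∷ range (suc a) n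

applyUpTo≡range : ∀ n a (g : ℕ → ℕ) → (∀ x → g x ≡ a + x) → applyUpTo g n ≡ range a n
applyUpTo≡range zero    a g g≗a+ = refl
applyUpTo≡range (suc n) a g g≗a+ = cong₂ _∷_ (trans (g≗a+ 0) (+-identityʳ a))
  (applyUpTo≡range n (suc a) (λ x → g (suc x)) (λ x → trans (g≗a+ (suc x)) (+-suc a x)))

applyUpTo-suc≡range : ∀ n → applyUpTo suc n ≡ range 1 n
applyUpTo-suc≡range n = applyUpTo≡range n 1 suc (λ _ → refl)

range-++ : ∀ a m n → range a (m + n) ≡ range a m ++ range (a + m) n
range-++ a zero    n rewrite +-identityʳ a = refl
range-++ a (suc m) n rewrite +-suc a m     = cong (a ∷_) (range-++ (suc a) m n)

range-bounds : ∀ a m → All (λ x → a ≤ x × x < a + m) (range a m)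
range-bounds a zero    = []
range-bounds a (suc m) rewrite +-suc a m =
  (≤-refl , s≤s (m≤m+n a m)) ∷
  All.map (λ (a<x , x<) → (≤-trans (n≤1+n a) a<x , x<)) (range-bounds (suc a) m)

All-reverse : ∀ {P : ℕ → Set} {xs} → All P xs → All P (reverse xs)
All-reverse {xs = xs} = All-resp-↭ (↭-sym (↭-reverse xs))

range-split : ∀ N p → 1 ≤ p → p < N → Splitting (range 1 N) p (suc p)
range-split N (suc m) _ m<N = record
  { before        = range 1 m
  ; after         = range (3 + m) n
  ; splits        = begin
      range 1 N                          ≡⟨ cong (range 1) (sym N≡m+2+n) ⟩
      range 1 (m + (2 + n))              ≡⟨ range-++ 1 m (2 + n) ⟩
      range 1 m ++ range (1 + m) (2 + n) ∎
  ; before-avoids = All.map (λ (_ , x<) → <⇒≢ x< , <⇒≢ (m<n⇒m<1+n x<)) (range-bounds 1 m)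
  ; after-avoids  = All.map (λ (<x , _) → ≢-sym (<⇒≢ (<-trans (n<1+n _) <x)) , ≢-sym (<⇒≢ <x))
                            (range-bounds (3 + m) n)
  }
  where
  open ≡-Reasoning
  n = N ∸ (2 + m)
  N≡m+2+n : m + (2 + n) ≡ N
  N≡m+2+n = trans (+-suc m (1 + n)) (trans (cong suc (+-suc m n)) (m+[n∸m]≡n m<N))

reverse-range-split : ∀ N p → 1 ≤ p → p < N → Splitting (reverse (range 1 N)) (suc p) p
reverse-range-split N p 1≤p p<N = record
  { before        = reverse vs
  ; after         = reverse us
  ; splits        = begin
      reverse (range 1 N)
        ≡⟨ cong reverse splits ⟩
      reverse (us ++ p ∷ suc p ∷ vs)
        ≡⟨ reverse-++ us (p ∷ suc p ∷ vs) ⟩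
      reverse (p ∷ suc p ∷ vs) ++ reverse us
        ≡⟨ cong (_++ reverse us) (reverse-++ (p ∷ suc p ∷ []) vs) ⟩
      (reverse vs ++ suc p ∷ p ∷ []) ++ reverse us
        ≡⟨ ++-assoc (reverse vs) (suc p ∷ p ∷ []) (reverse us) ⟩
      reverse vs ++ suc p ∷ p ∷ reverse us
        ∎
  ; before-avoids = All-reverse (All.map swap after-avoids)
  ; after-avoids  = All-reverse (All.map swap before-avoids)
  }
  where
  open ≡-Reasoning
  open Splitting (range-split N p 1≤p p<N) renaming (before to us; after to vs)
  swap : ∀ {x} → x ≢ p × x ≢ suc p → x ≢ suc p × x ≢ p
  swap (≢p , ≢sp) = ≢sp , ≢p

module _ (f s : ℕ → Bool) {M N : ℕ} (M≤N : M ≤ N)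
         (blank : ∀ x → M < x → f x ≡ false × s x ≡ false) where

  private
    tail = range (1 + M) (N ∸ M)

    range-M+tail : range 1 M ++ tail ≡ range 1 N
    range-M+tail = trans (sym (range-++ 1 M (N ∸ M))) (cong (range 1) (m+[n∸m]≡n M≤N))

    tail-blank : All (λ x → f x ≡ false × s x ≡ false) tail
    tail-blank = All.map (λ (M<x , _) → blank _ M<x) (range-bounds (1 + M) (N ∸ M))

  unpairedScan-range-pad : unpairedScan f s (range 1 M) 0 ≡ unpairedScan f s (range 1 N) 0
  unpairedScan-range-pad = begin
    unpairedScan f s (range 1 M) 0
      ≡⟨ sym (++-identityʳ _) ⟩
    unpairedScan f s (range 1 M) 0 ++ []
      ≡⟨ cong (unpairedScan f s (range 1 M) 0 ++_)
              (sym (proj₁ (unpairedScan-blank f s tail _ tail-blank))) ⟩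
    unpairedScan f s (range 1 M) 0 ++ unpairedScan f s tail (scanCount f s (range 1 M) 0)
      ≡⟨ sym (unpairedScan-++ f s (range 1 M) tail 0) ⟩
    unpairedScan f s (range 1 M ++ tail) 0
      ≡⟨ cong (λ ps → unpairedScan f s ps 0) range-M+tail ⟩
    unpairedScan f s (range 1 N) 0 ∎
    where open ≡-Reasoning

  unpairedScan-reverse-range-pad :
    unpairedScan f s (reverse (range 1 M)) 0 ≡ unpairedScan f s (reverse (range 1 N)) 0
  unpairedScan-reverse-range-pad = begin
    unpairedScan f s (reverse (range 1 M)) 0
      ≡⟨ cong (unpairedScan f s (reverse (range 1 M))) (sym (proj₂ blank-prefix)) ⟩
    unpairedScan f s (reverse (range 1 M)) (scanCount f s (reverse tail) 0)
      ≡⟨ cong (_++ unpairedScan f s (reverse (range 1 M)) (scanCount f s (reverse tail) 0))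
              (sym (proj₁ blank-prefix)) ⟩
    unpairedScan f s (reverse tail) 0 ++ unpairedScan f s (reverse (range 1 M)) (scanCount f s (reverse tail) 0)
      ≡⟨ sym (unpairedScan-++ f s (reverse tail) _ 0) ⟩
    unpairedScan f s (reverse tail ++ reverse (range 1 M)) 0
      ≡⟨ cong (λ ps → unpairedScan f s ps 0) (sym (reverse-++ (range 1 M) tail)) ⟩
    unpairedScan f s (reverse (range 1 M ++ tail)) 0
      ≡⟨ cong (λ ps → unpairedScan f s (reverse ps) 0) range-M+tail ⟩
    unpairedScan f s (reverse (range 1 N)) 0 ∎
    where
    open ≡-Reasoning
    blank-prefix = unpairedScan-blank f s (reverse tail) 0 (All-reverse tail-blank)

vScan : ℕ → Diagram → ℕ → List ℕ
vScan r X N = unpairedScan (mem X r) (mem X (suc r)) (range 1 N) 0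

hScan : ℕ → Diagram → ℕ → List ℕ
hScan i X N = unpairedScan (λ x → mem X x i) (λ x → mem X x (suc i)) (reverse (range 1 N)) 0

vUnpaired≡vScan : ∀ r X N → maxCol X ≤ N → vUnpaired r X ≡ vScan r X N
vUnpaired≡vScan r X N le rewrite applyUpTo-suc≡range (maxCol X) =
  unpairedScan-range-pad (mem X r) (mem X (suc r)) le
    (λ x lt → >maxCol⇒mem-false X r x lt , >maxCol⇒mem-false X (suc r) x lt)

hUnpaired≡hScan : ∀ i X N → maxRow X ≤ N → hUnpaired i X ≡ hScan i X N
hUnpaired≡hScan i X N le rewrite applyUpTo-suc≡range (maxRow X) =
  unpairedScan-reverse-range-pad (λ x → mem X x i) (λ x → mem X x (suc i)) le
    (λ x lt → >maxRow⇒mem-false X x i lt , >maxRow⇒mem-false X x (suc i) lt)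

e~-unpaired : ∀ r X {c} → lastM (vUnpaired r X) ≡ just c → e~ r X ≡ just (move (suc r , c) (r , c) X)
e~-unpaired r X e rewrite e = refl

e~-paired : ∀ r X → lastM (vUnpaired r X) ≡ nothing → e~ r X ≡ nothing
e~-paired r X e rewrite e = refl

e~-just⇒ : ∀ r X {Y} → e~ r X ≡ just Y →
  ∃[ c ] lastM (vUnpaired r X) ≡ just c × Y ≡ move (suc r , c) (r , c) X
e~-just⇒ r X e with lastM (vUnpaired r X)
e~-just⇒ r X refl | just c = c , refl , refl

e~-nothing⇒ : ∀ r X → e~ r X ≡ nothing → lastM (vUnpaired r X) ≡ nothing
e~-nothing⇒ r X e with lastM (vUnpaired r X)
e~-nothing⇒ r X e  | nothing = refl
e~-nothing⇒ r X () | just _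

E~-unpaired : ∀ i X {a} → lastM (hUnpaired i X) ≡ just a → E~ i X ≡ just (move (a , suc i) (a , i) X)
E~-unpaired i X e rewrite e = refl

E~-paired : ∀ i X → lastM (hUnpaired i X) ≡ nothing → E~ i X ≡ nothing
E~-paired i X e rewrite e = refl

E~-just⇒ : ∀ i X {Y} → E~ i X ≡ just Y →
  ∃[ a ] lastM (hUnpaired i X) ≡ just a × Y ≡ move (a , suc i) (a , i) X
E~-just⇒ i X e with lastM (hUnpaired i X)
E~-just⇒ i X refl | just a = a , refl , refl

E~-nothing⇒ : ∀ i X → E~ i X ≡ nothing → lastM (hUnpaired i X) ≡ nothing
E~-nothing⇒ i X e with lastM (hUnpaired i X)
E~-nothing⇒ i X e  | nothing = refl
E~-nothing⇒ i X () | just _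

hUnpaired-unpaired : ∀ i X → All (λ a → mem X a i ≡ false × mem X a (suc i) ≡ true) (hUnpaired i X)
hUnpaired-unpaired i X =
  unpairedScan-unpaired (λ a → mem X a i) (λ a → mem X a (suc i)) (reverse (applyUpTo suc (maxRow X))) 0

E~-colSum : ∀ j X {Y} → E~ j X ≡ just Y → colSum Y < colSum X
E~-colSum j X e with E~-just⇒ j X e
... | a , last≡a , refl = colSum-remove X (mem⇒∈ X a (suc j) (proj₂ chosen))
  where chosen = lastM-All _ (hUnpaired-unpaired j X) last≡a

E~-beyond-maxCol : ∀ j X → maxCol X ≤ j → E~ j X ≡ nothing
E~-beyond-maxCol j X le = E~-paired j X no-last
  where
  no-last : lastM (hUnpaired j X) ≡ nothing
  no-last with lastM (hUnpaired j X) in e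
  ... | nothing = refl
  ... | just a  =
    ⊥-elim (false≢true (trans (sym (>maxCol⇒mem-false X a (suc j) (s≤s le))) (proj₂ chosen)))
    where chosen = lastM-All _ (hUnpaired-unpaired j X) e

E~-cong : ∀ j {X X'} → X ≐ X' → Pointwise _≐_ (E~ j X) (E~ j X')
E~-cong j {X} {X'} X≐X' = by-last (lastM (hUnpaired j X)) refl (sym same-last)
  where
  N = maxRow X ⊔ maxRow X'
  same-last : lastM (hUnpaired j X) ≡ lastM (hUnpaired j X')
  same-last = cong lastM (trans (hUnpaired≡hScan j X N (m≤m⊔n _ _))
    (trans (proj₁ (unpairedScan-cong (reverse (range 1 N)) 0
                     (All.universal (λ x → X≐X' x j , X≐X' x (suc j)) _)))
           (sym (hUnpaired≡hScan j X' N (m≤n⊔m _ _)))))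
  by-last : ∀ m → lastM (hUnpaired j X) ≡ m → lastM (hUnpaired j X') ≡ m →
    Pointwise _≐_ (E~ j X) (E~ j X')
  by-last nothing  e e' rewrite E~-paired j X e | E~-paired j X' e' = nothing
  by-last (just a) e e' rewrite E~-unpaired j X e | E~-unpaired j X' e' =
    just (move-cong {X} {X'} (a , suc j) (a , j) X≐X')

firstE-just⇒ : ∀ X js {Y} → firstE X js ≡ just Y → ∃[ j ] j ∈ js × E~ j X ≡ just Y
firstE-just⇒ X (j ∷ js) e with E~ j X in eⱼ
... | nothing = let (j' , j'∈ , e') = firstE-just⇒ X js e in j' , there j'∈ , e'
firstE-just⇒ X (j ∷ js) refl | just _ = j , here refl , eⱼ

firstE-pointwise : ∀ (R : Diagram → Diagram → Set) X X' js →
  (∀ {j} → j ∈ js → Pointwise R (E~ j X) (E~ j X')) → Pointwise R (firstE X js) (firstE X' js)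
firstE-pointwise R X X' []       sim = nothing
firstE-pointwise R X X' (j ∷ js) sim with E~ j X | E~ j X' | sim (here refl)
... | just _  | just _  | just RYY' = just RYY'
... | nothing | nothing | nothing   = firstE-pointwise R X X' js (λ j∈ → sim (there j∈))

firstE-beyond-maxCol : ∀ X js → All (maxCol X ≤_) js → firstE X js ≡ nothing
firstE-beyond-maxCol X []       []        = refl
firstE-beyond-maxCol X (j ∷ js) (le ∷ les) rewrite E~-beyond-maxCol j X le = firstE-beyond-maxCol X js les

firstE-++-nothing : ∀ X xs ys → firstE X ys ≡ nothing → firstE X (xs ++ ys) ≡ firstE X xs
firstE-++-nothing X []       ys e = e
firstE-++-nothing X (x ∷ xs) ys e with E~ x X
... | nothing = firstE-++-nothing X xs ys e
... | just _  = refl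

rectStep : Diagram → Maybe Diagram
rectStep X = firstE X (applyUpTo suc (maxCol X))

rectStep≡firstE-range : ∀ X M → maxCol X ≤ M → rectStep X ≡ firstE X (range 1 M)
rectStep≡firstE-range X M le = begin
  firstE X (applyUpTo suc (maxCol X))
    ≡⟨ cong (firstE X) (applyUpTo-suc≡range (maxCol X)) ⟩
  firstE X (range 1 (maxCol X))
    ≡⟨ sym (firstE-++-nothing X (range 1 (maxCol X)) tail (firstE-beyond-maxCol X tail beyond)) ⟩
  firstE X (range 1 (maxCol X) ++ tail)
    ≡⟨ cong (firstE X) (sym (range-++ 1 (maxCol X) _)) ⟩
  firstE X (range 1 (maxCol X + (M ∸ maxCol X)))
    ≡⟨ cong (λ n → firstE X (range 1 n)) (m+[n∸m]≡n le) ⟩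
  firstE X (range 1 M)
    ∎
  where
  open ≡-Reasoning
  tail = range (1 + maxCol X) (M ∸ maxCol X)
  beyond = All.map (λ (lt , _) → ≤-trans (n≤1+n _) lt) (range-bounds (1 + maxCol X) (M ∸ maxCol X))

rectStep-pointwise : ∀ (R : Diagram → Diagram → Set) X X' →
  (∀ j → 1 ≤ j → Pointwise R (E~ j X) (E~ j X')) → Pointwise R (rectStep X) (rectStep X')
rectStep-pointwise R X X' sim =
  subst₂ (Pointwise R) (sym (rectStep≡firstE-range X M (m≤m⊔n _ _)))
                       (sym (rectStep≡firstE-range X' M (m≤n⊔m _ _)))
    (firstE-pointwise R X X' (range 1 M) (λ j∈ → sim _ (proj₁ (All.lookup (range-bounds 1 M) j∈))))
  where M = maxCol X ⊔ maxCol X'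

rectStep-colSum : ∀ X {Y} → rectStep X ≡ just Y → colSum Y < colSum X
rectStep-colSum X e with firstE-just⇒ X (applyUpTo suc (maxCol X)) e
... | j , _ , eⱼ = E~-colSum j X eⱼ

rectF-suc : ∀ n X → rectF (suc n) X ≡ maybe (rectF n) X (rectStep X)
rectF-suc n X with firstE X (applyUpTo suc (maxCol X))
... | nothing = refl
... | just _  = refl

rectF-invariant : ∀ (P : Diagram → Set) →
  (∀ {X Y} j → 1 ≤ j → P X → E~ j X ≡ just Y → P Y) →
  ∀ n {X} → P X → P (rectF n X)
rectF-invariant P inv zero    PX = PX
rectF-invariant P inv (suc n) {X} PX rewrite rectF-suc n X with rectStep X in e
... | nothing = PX
... | just Y with firstE-just⇒ X (applyUpTo suc (maxCol X)) e
...   | j , j∈ , eⱼ with ∈-applyUpTo⁻ suc j∈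
...     | k , _ , refl = rectF-invariant P inv n (inv (suc k) (s≤s z≤n) PX eⱼ)

rectF-simulation : ∀ (R : Diagram → Diagram → Set) →
  (∀ {X X'} → R X X' → ∀ j → 1 ≤ j → Pointwise R (E~ j X) (E~ j X')) →
  ∀ n m {X X'} → R X X' → colSum X < n → colSum X' < m → R (rectF n X) (rectF m X')
rectF-simulation R step (suc n) (suc m) {X} {X'} RXX' lt lt'
  rewrite rectF-suc n X | rectF-suc m X'
  with rectStep X in e | rectStep X' in e' | rectStep-pointwise R X X' (step RXX')
... | nothing | nothing | nothing   = RXX'
... | just Y  | just Y' | just RYY' = rectF-simulation R step n m RYY'
  (<-≤-trans (rectStep-colSum X e) (≤-pred lt)) (<-≤-trans (rectStep-colSum X' e') (≤-pred lt'))

Lowered : ℕ → Diagram → Diagram → Set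
Lowered r X X' = ∃[ Z ] e~ r X ≡ just Z × Z ≐ X'

module Commutation (r i : ℕ) (1≤r : 1 ≤ r) (1≤i : 1 ≤ i) (D : Diagram) where

  -- Exceeds every coordinate of D and of the diagrams one move away from D, so that all their
  -- scans can be compared on the common range 1 … N.
  N : ℕ
  N = suc (maxCol D ⊔ maxRow D)

  rowᵣ rowᵣ₊₁ colᵢ colᵢ₊₁ : Diagram → ℕ → Bool
  rowᵣ   X = mem X r
  rowᵣ₊₁ X = mem X (suc r)
  colᵢ   X a = mem X a i
  colᵢ₊₁ X a = mem X a (suc i)

  vLast hLast : Diagram → Maybe ℕ
  vLast X = lastM (vScan r X N)
  hLast X = lastM (hScan i X N)

  vWindow hWindow : Diagram → Window
  vWindow X = windowAt (rowᵣ X) (rowᵣ₊₁ X) i (suc i)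
  hWindow X = windowAt (colᵢ X) (colᵢ₊₁ X) (suc r) r

  eMove EMove : ℕ → Diagram
  eMove c = move (suc r , c) (r , c) D
  EMove a = move (a , suc i) (a , i) D

  Bounded : Diagram → Set
  Bounded X = maxCol X ≤ maxCol D × maxRow X ≤ maxRow D

  lastM-vUnpaired : ∀ X → Bounded X → lastM (vUnpaired r X) ≡ vLast X
  lastM-vUnpaired X (col≤ , _) =
    cong lastM (vUnpaired≡vScan r X N (≤-trans col≤ (≤-trans (m≤m⊔n _ _) (n≤1+n _))))

  lastM-hUnpaired : ∀ X → Bounded X → lastM (hUnpaired i X) ≡ hLast X
  lastM-hUnpaired X (_ , row≤) =
    cong lastM (hUnpaired≡hScan i X N (≤-trans row≤ (≤-trans (m≤n⊔m _ _) (n≤1+n _))))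

  D-bounded : Bounded D
  D-bounded = ≤-refl , ≤-refl

  eMove-bounded : ∀ {c} → mem D (suc r) c ≡ true → Bounded (eMove c)
  eMove-bounded {c} cell =
    maxOf-move proj₂ _ (r , c) D (mem⇒≤maxCol D (suc r) c cell) ,
    maxOf-move proj₁ _ (r , c) D (≤-trans (n≤1+n r) (mem⇒≤maxRow D (suc r) c cell))

  EMove-bounded : ∀ {a} → mem D a (suc i) ≡ true → Bounded (EMove a)
  EMove-bounded {a} cell =
    maxOf-move proj₂ _ (a , i) D (≤-trans (n≤1+n i) (mem⇒≤maxCol D a (suc i) cell)) ,
    maxOf-move proj₁ _ (a , i) D (mem⇒≤maxRow D a (suc i) cell)

  ≤maxCol⇒<N : ∀ {x} → x ≤ maxCol D → x < N
  ≤maxCol⇒<N le = s≤s (≤-trans le (m≤m⊔n _ _))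

  ≤maxRow⇒<N : ∀ {x} → x ≤ maxRow D → x < N
  ≤maxRow⇒<N le = s≤s (≤-trans le (m≤n⊔m _ _))

  columns-split : ∀ a → mem D a (suc i) ≡ true → Splitting (range 1 N) i (suc i)
  columns-split a cell =
    range-split N i 1≤i (≤maxCol⇒<N (≤-trans (n≤1+n i) (mem⇒≤maxCol D a (suc i) cell)))

  rows-split : ∀ c → mem D (suc r) c ≡ true → Splitting (reverse (range 1 N)) (suc r) r
  rows-split c cell =
    reverse-range-split N r 1≤r (≤maxRow⇒<N (≤-trans (n≤1+n r) (mem⇒≤maxRow D (suc r) c cell)))

  vChosen : ∀ {c} → vLast D ≡ just c → mem D r c ≡ false × mem D (suc r) c ≡ true × 1 ≤ c
  vChosen {c} e = proj₁ unpaired , proj₂ unpaired ,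
    proj₁ (lastM-All _ (unpairedScan-All (rowᵣ D) (rowᵣ₊₁ D) (range 1 N) 0 (range-bounds 1 N)) e)
    where unpaired = lastM-All _ (unpairedScan-unpaired (rowᵣ D) (rowᵣ₊₁ D) (range 1 N) 0) e

  hChosen : ∀ {a} → hLast D ≡ just a → mem D a i ≡ false × mem D a (suc i) ≡ true × 1 ≤ a
  hChosen {a} e = proj₁ unpaired , proj₂ unpaired ,
    proj₁ (lastM-All _ (unpairedScan-All (colᵢ D) (colᵢ₊₁ D) _ 0 (All-reverse (range-bounds 1 N))) e)
    where unpaired = lastM-All _ (unpairedScan-unpaired (colᵢ D) (colᵢ₊₁ D) (reverse (range 1 N)) 0) e

  vChosen-right : ∀ {c} → vLast D ≡ just c →
    mem D r (suc c) ≡ false → mem D (suc r) (suc c) ≡ true → ⊥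
  vChosen-right {c} e with vChosen e
  ... | _ , cell , 1≤c =
    lastUnpaired-next (rowᵣ D) (rowᵣ₊₁ D)
      (range-split N c 1≤c (≤maxCol⇒<N (mem⇒≤maxCol D (suc r) c cell))) 1+n≢n e

  vChosen-left : vLast D ≡ just (suc i) → mem D r i ≡ true → mem D (suc r) i ≡ false → ⊥
  vChosen-left e =
    lastUnpaired-prev (rowᵣ D) (rowᵣ₊₁ D) (columns-split (suc r) (proj₁ (proj₂ (vChosen e)))) e

  hChosen-above : ∀ {a} → hLast D ≡ just a →
    mem D (suc a) i ≡ true → mem D (suc a) (suc i) ≡ false → ⊥
  hChosen-above {a} e with hChosen e
  ... | _ , cell , 1≤a =
    lastUnpaired-prev (colᵢ D) (colᵢ₊₁ D)
      (reverse-range-split N a 1≤a (≤maxRow⇒<N (mem⇒≤maxRow D a (suc i) cell))) e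

  hChosen-below : hLast D ≡ just (suc r) → mem D r i ≡ false → mem D r (suc i) ≡ true → ⊥
  hChosen-below e =
    lastUnpaired-next (colᵢ D) (colᵢ₊₁ D) (rows-split (suc i) (proj₁ (proj₂ (hChosen e)))) n≢1+n e

  EMove-window : ∀ {a} → hLast D ≡ just a → a ≡ r ⊎ a ≡ suc r →
    Replaceable (vWindow D) (vWindow (EMove a))
  EMove-window e (inj₁ refl)
    rewrite proj₁ (hChosen e) | proj₁ (proj₂ (hChosen e))
          | mem-move-target D (r , suc i) (r , i) | mem-move-source D {r , suc i} {r , i} (col≢ 1+n≢n)
          | mem-move-other D {r , suc i} {r , i} (suc r) i (row≢ 1+n≢n) (row≢ 1+n≢n)
          | mem-move-other D {r , suc i} {r , i} (suc r) (suc i) (row≢ 1+n≢n) (row≢ 1+n≢n)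
    = shift-first-earlier (mem D (suc r) i) (mem D (suc r) (suc i)) (hChosen-above e)
  EMove-window e (inj₂ refl)
    rewrite proj₁ (hChosen e) | proj₁ (proj₂ (hChosen e))
          | mem-move-target D (suc r , suc i) (suc r , i)
          | mem-move-source D {suc r , suc i} {suc r , i} (col≢ 1+n≢n)
          | mem-move-other D {suc r , suc i} {suc r , i} r i (row≢ n≢1+n) (row≢ n≢1+n)
          | mem-move-other D {suc r , suc i} {suc r , i} r (suc i) (row≢ n≢1+n) (row≢ n≢1+n)
    = shift-second-earlier (mem D r i) (mem D r (suc i)) (hChosen-below e)

  eMove-window : ∀ {c} → vLast D ≡ just c → c ≡ i ⊎ c ≡ suc i →
    Replaceable (hWindow D) (hWindow (eMove c))
  eMove-window e (inj₁ refl)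
    rewrite proj₁ (vChosen e) | proj₁ (proj₂ (vChosen e))
          | mem-move-target D (suc r , i) (r , i) | mem-move-source D {suc r , i} {r , i} (row≢ 1+n≢n)
          | mem-move-other D {suc r , i} {r , i} (suc r) (suc i) (col≢ 1+n≢n) (col≢ 1+n≢n)
          | mem-move-other D {suc r , i} {r , i} r (suc i) (col≢ 1+n≢n) (col≢ 1+n≢n)
    = shift-first-later (mem D (suc r) (suc i)) (mem D r (suc i)) (λ x y → vChosen-right e y x)
  eMove-window e (inj₂ refl)
    rewrite proj₁ (vChosen e) | proj₁ (proj₂ (vChosen e))
          | mem-move-target D (suc r , suc i) (r , suc i)
          | mem-move-source D {suc r , suc i} {r , suc i} (row≢ 1+n≢n)
          | mem-move-other D {suc r , suc i} {r , suc i} (suc r) i (col≢ n≢1+n) (col≢ n≢1+n)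
          | mem-move-other D {suc r , suc i} {r , suc i} r i (col≢ n≢1+n) (col≢ n≢1+n)
    = shift-second-later (mem D (suc r) i) (mem D r i) (λ x y → vChosen-left e y x)

  EMove-agree : ∀ a x → x ≢ i → x ≢ suc i →
    Agree (rowᵣ D) (rowᵣ₊₁ D) (rowᵣ (EMove a)) (rowᵣ₊₁ (EMove a)) x
  EMove-agree a x x≢i x≢si =
    sym (mem-move-other D {a , suc i} {a , i} r x (col≢ x≢i) (col≢ x≢si)) ,
    sym (mem-move-other D {a , suc i} {a , i} (suc r) x (col≢ x≢i) (col≢ x≢si))

  eMove-agree : ∀ c x → x ≢ suc r → x ≢ r →
    Agree (colᵢ D) (colᵢ₊₁ D) (colᵢ (eMove c)) (colᵢ₊₁ (eMove c)) x
  eMove-agree c x x≢sr x≢r =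
    sym (mem-move-other D {suc r , c} {r , c} x i (row≢ x≢r) (row≢ x≢sr)) ,
    sym (mem-move-other D {suc r , c} {r , c} x (suc i) (row≢ x≢r) (row≢ x≢sr))

  vLast-EMove-other : ∀ {a} → a ≢ r → a ≢ suc r → vLast (EMove a) ≡ vLast D
  vLast-EMove-other {a} a≢r a≢sr =
    cong lastM (proj₁ (unpairedScan-cong (range 1 N) 0 (All.universal unchanged _)))
    where
    unchanged : ∀ x → Agree (rowᵣ (EMove a)) (rowᵣ₊₁ (EMove a)) (rowᵣ D) (rowᵣ₊₁ D) x
    unchanged x = mem-move-other D {a , suc i} {a , i} r x (row≢ (≢-sym a≢r)) (row≢ (≢-sym a≢r)) ,
                  mem-move-other D {a , suc i} {a , i} (suc r) x
                    (row≢ (≢-sym a≢sr)) (row≢ (≢-sym a≢sr))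

  hLast-eMove-other : ∀ {c} → c ≢ i → c ≢ suc i → hLast (eMove c) ≡ hLast D
  hLast-eMove-other {c} c≢i c≢si =
    cong lastM (proj₁ (unpairedScan-cong (reverse (range 1 N)) 0 (All.universal unchanged _)))
    where
    unchanged : ∀ x → Agree (colᵢ (eMove c)) (colᵢ₊₁ (eMove c)) (colᵢ D) (colᵢ₊₁ D) x
    unchanged x = mem-move-other D {suc r , c} {r , c} x i (col≢ (≢-sym c≢i)) (col≢ (≢-sym c≢i)) ,
                  mem-move-other D {suc r , c} {r , c} x (suc i)
                    (col≢ (≢-sym c≢si)) (col≢ (≢-sym c≢si))

  module EMoveInVScan {a} (e : hLast D ≡ just a) =
    WindowChange (rowᵣ D) (rowᵣ₊₁ D) (rowᵣ (EMove a)) (rowᵣ₊₁ (EMove a))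
                 (columns-split a (proj₁ (proj₂ (hChosen e)))) (EMove-agree a)

  module eMoveInHScan {c} (e : vLast D ≡ just c) =
    WindowChange (colᵢ D) (colᵢ₊₁ D) (colᵢ (eMove c)) (colᵢ₊₁ (eMove c))
                 (rows-split c (proj₁ (proj₂ (vChosen e)))) (eMove-agree c)

  vLast-EMove-silent : ∀ {a} → hLast D ≡ just a → vLast D ≡ nothing → vLast (EMove a) ≡ nothing
  vLast-EMove-silent {a} e silent with pair-cases a r
  ... | inj₁ a∈ = EMoveInVScan.silent-preserved e (EMove-window e a∈) silent
  ... | inj₂ (a≢r , a≢sr) = trans (vLast-EMove-other a≢r a≢sr) silent

  vLast-EMove-stable : ∀ {a c} → hLast D ≡ just a → c ≢ i → c ≢ suc i →
    vLast D ≡ just c → vLast (EMove a) ≡ just c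
  vLast-EMove-stable {a} e c≢i c≢si last with pair-cases a r
  ... | inj₁ a∈ = EMoveInVScan.last-preserved e (EMove-window e a∈) (≢-sym c≢i) (≢-sym c≢si) last
  ... | inj₂ (a≢r , a≢sr) = trans (vLast-EMove-other a≢r a≢sr) last

  hLast-eMove-silent : ∀ {c} → vLast D ≡ just c → hLast D ≡ nothing → hLast (eMove c) ≡ nothing
  hLast-eMove-silent {c} e silent with pair-cases c i
  ... | inj₁ c∈ = eMoveInHScan.silent-preserved e (eMove-window e c∈) silent
  ... | inj₂ (c≢i , c≢si) = trans (hLast-eMove-other c≢i c≢si) silent

  hLast-eMove-stable : ∀ {c a} → vLast D ≡ just c → a ≢ r → a ≢ suc r →
    hLast D ≡ just a → hLast (eMove c) ≡ just a
  hLast-eMove-stable {c} e a≢r a≢sr last with pair-cases c i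
  ... | inj₁ c∈ = eMoveInHScan.last-preserved e (eMove-window e c∈) (≢-sym a≢sr) (≢-sym a≢r) last
  ... | inj₂ (c≢i , c≢si) = trans (hLast-eMove-other c≢i c≢si) last

  cross-vLast₁ : vLast D ≡ just i → hLast D ≡ just r → vLast (EMove r) ≡ just (suc i)
  cross-vLast₁ ve he = EMoveInVScan.last-retargeted he (inj₁ refl) retarget ve
    where
    retarget : Retargets (vWindow D) (vWindow (EMove r)) i (suc i) i (suc i)
    retarget
      rewrite mem-move-target D (r , suc i) (r , i) | mem-move-source D {r , suc i} {r , i} (col≢ 1+n≢n)
            | mem-move-other D {r , suc i} {r , i} (suc r) i (row≢ 1+n≢n) (row≢ 1+n≢n)
            | mem-move-other D {r , suc i} {r , i} (suc r) (suc i) (row≢ 1+n≢n) (row≢ 1+n≢n)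
            | ¬-not (hChosen-above he (proj₁ (proj₂ (vChosen ve))))
            | proj₁ (hChosen he) | proj₁ (proj₂ (hChosen he)) | proj₁ (proj₂ (vChosen ve))
      = retarget-first-earlier i (suc i)

  cross-hLast₁ : vLast D ≡ just i → hLast D ≡ just r → hLast (eMove i) ≡ just (suc r)
  cross-hLast₁ ve he = eMoveInHScan.last-retargeted ve (inj₂ refl) retarget he
    where
    retarget : Retargets (hWindow D) (hWindow (eMove i)) (suc r) r r (suc r)
    retarget
      rewrite mem-move-target D (suc r , i) (r , i) | mem-move-source D {suc r , i} {r , i} (row≢ 1+n≢n)
            | mem-move-other D {suc r , i} {r , i} (suc r) (suc i) (col≢ 1+n≢n) (col≢ 1+n≢n)
            | mem-move-other D {suc r , i} {r , i} r (suc i) (col≢ 1+n≢n) (col≢ 1+n≢n)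
            | ¬-not (hChosen-above he (proj₁ (proj₂ (vChosen ve))))
            | proj₁ (hChosen he) | proj₁ (proj₂ (hChosen he)) | proj₁ (proj₂ (vChosen ve))
      = retarget-first-later (suc r) r

  cross-vLast₂ : vLast D ≡ just (suc i) → hLast D ≡ just (suc r) → vLast (EMove (suc r)) ≡ just i
  cross-vLast₂ ve he = EMoveInVScan.last-retargeted he (inj₂ refl) retarget ve
    where
    retarget : Retargets (vWindow D) (vWindow (EMove (suc r))) i (suc i) (suc i) i
    retarget
      rewrite mem-move-target D (suc r , suc i) (suc r , i)
            | mem-move-source D {suc r , suc i} {suc r , i} (col≢ 1+n≢n)
            | mem-move-other D {suc r , suc i} {suc r , i} r i (row≢ n≢1+n) (row≢ n≢1+n)
            | mem-move-other D {suc r , suc i} {suc r , i} r (suc i) (row≢ n≢1+n) (row≢ n≢1+n)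
            | ¬-not (λ rᵢ → vChosen-left ve rᵢ (proj₁ (hChosen he)))
            | proj₁ (hChosen he) | proj₁ (proj₂ (hChosen he)) | proj₁ (vChosen ve)
      = retarget-second-earlier i (suc i)

  cross-hLast₂ : vLast D ≡ just (suc i) → hLast D ≡ just (suc r) → hLast (eMove (suc i)) ≡ just r
  cross-hLast₂ ve he = eMoveInHScan.last-retargeted ve (inj₁ refl) retarget he
    where
    retarget : Retargets (hWindow D) (hWindow (eMove (suc i))) (suc r) r (suc r) r
    retarget
      rewrite mem-move-target D (suc r , suc i) (r , suc i)
            | mem-move-source D {suc r , suc i} {r , suc i} (row≢ 1+n≢n)
            | mem-move-other D {suc r , suc i} {r , suc i} (suc r) i (col≢ n≢1+n) (col≢ n≢1+n)
            | mem-move-other D {suc r , suc i} {r , suc i} r i (col≢ n≢1+n) (col≢ n≢1+n)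
            | ¬-not (λ rᵢ → vChosen-left ve rᵢ (proj₁ (hChosen he)))
            | proj₁ (hChosen he) | proj₁ (proj₂ (hChosen he)) | proj₁ (vChosen ve)
      = retarget-second-later (suc r) r

  record Commuting (c a : ℕ) : Set where
    field
      {c' a'}  : ℕ
      vLast≡c' : vLast (EMove a) ≡ just c'
      hLast≡a' : hLast (eMove c) ≡ just a'
      same     : move (suc r , c') (r , c') (EMove a) ≐ move (a' , suc i) (a' , i) (eMove c)

  commuting : ∀ {c a} → vLast D ≡ just c → hLast D ≡ just a → Commuting c a
  commuting {c} {a} ve he with pair-cases a r | pair-cases c i
  ... | inj₂ (a≢r , a≢sr) | _ = record
    { vLast≡c' = trans (vLast-EMove-other a≢r a≢sr) ve
    ; hLast≡a' = hLast-eMove-stable ve a≢r a≢sr he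
    ; same     = move-comm D {suc r , c} {r , c} {a , suc i} {a , i} (row≢ (≢-sym a≢r)) (row≢ a≢sr)
    }
  ... | inj₁ _ | inj₂ (c≢i , c≢si) = record
    { vLast≡c' = vLast-EMove-stable he c≢i c≢si ve
    ; hLast≡a' = trans (hLast-eMove-other c≢i c≢si) he
    ; same     = move-comm D {suc r , c} {r , c} {a , suc i} {a , i} (col≢ c≢si) (col≢ (≢-sym c≢i))
    }
  ... | inj₁ (inj₁ refl) | inj₁ (inj₁ refl) = record
    { vLast≡c' = cross-vLast₁ ve he
    ; hLast≡a' = cross-hLast₁ ve he
    ; same     = λ u v → trans
        (move-via-occupied D {suc r , suc i} {r , suc i} {r , i} (proj₁ (proj₂ (hChosen he)))
           (col≢ n≢1+n) (row≢ n≢1+n) (row≢ n≢1+n) u v)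
        (sym (move-via-occupied D {suc r , suc i} {suc r , i} {r , i} (proj₁ (proj₂ (vChosen ve)))
           (row≢ n≢1+n) (col≢ n≢1+n) (row≢ n≢1+n) u v))
    }
  ... | inj₁ (inj₂ refl) | inj₁ (inj₂ refl) = record
    { vLast≡c' = cross-vLast₂ ve he
    ; hLast≡a' = cross-hLast₂ ve he
    ; same     = λ u v → trans
        (move-via-empty D {suc r , suc i} {suc r , i} {r , i} (proj₁ (hChosen he)) (col≢ n≢1+n) u v)
        (sym (move-via-empty D {suc r , suc i} {r , suc i} {r , i} (proj₁ (vChosen ve)) (row≢ n≢1+n) u v))
    }
  ... | inj₁ (inj₁ refl) | inj₁ (inj₂ refl) =
    ⊥-elim (false≢true (trans (sym (proj₁ (vChosen ve))) (proj₁ (proj₂ (hChosen he)))))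
  ... | inj₁ (inj₂ refl) | inj₁ (inj₁ refl) =
    ⊥-elim (false≢true (trans (sym (proj₁ (hChosen he))) (proj₁ (proj₂ (vChosen ve)))))

  E~-Lowered : ∀ {D₁} → e~ r D ≡ just D₁ → Pointwise (Lowered r) (E~ i D) (E~ i D₁)
  E~-Lowered e₁ with e~-just⇒ r D e₁
  ... | c , vc , refl = by-hLast (lastM (hUnpaired i D)) refl
    where
    ve : vLast D ≡ just c
    ve = trans (sym (lastM-vUnpaired D D-bounded)) vc
    c-bounded = eMove-bounded (proj₁ (proj₂ (vChosen ve)))

    by-hLast : ∀ m → lastM (hUnpaired i D) ≡ m → Pointwise (Lowered r) (E~ i D) (E~ i (eMove c))
    by-hLast nothing hn = subst₂ (Pointwise (Lowered r)) (sym (E~-paired i D hn))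
      (sym (E~-paired i (eMove c) (trans (lastM-hUnpaired (eMove c) c-bounded)
        (hLast-eMove-silent ve (trans (sym (lastM-hUnpaired D D-bounded)) hn)))))
      nothing
    by-hLast (just a) ha = subst₂ (Pointwise (Lowered r)) (sym (E~-unpaired i D ha))
      (sym (E~-unpaired i (eMove c) (trans (lastM-hUnpaired (eMove c) c-bounded) hLast≡a')))
      (just (_ , e~-unpaired r (EMove a) (trans (lastM-vUnpaired (EMove a) a-bounded) vLast≡c') , same))
      where
      he = trans (sym (lastM-hUnpaired D D-bounded)) ha
      a-bounded = EMove-bounded (proj₁ (proj₂ (hChosen he)))
      open Commuting (commuting ve he)

  e~-E~-silent : ∀ {D'} → e~ r D ≡ nothing → E~ i D ≡ just D' → e~ r D' ≡ nothing
  e~-E~-silent en eE with E~-just⇒ i D eE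
  ... | a , ha , refl =
    e~-paired r (EMove a)
      (trans (lastM-vUnpaired (EMove a) (EMove-bounded (proj₁ (proj₂ (hChosen he)))))
             (vLast-EMove-silent he vn))
    where
    he = trans (sym (lastM-hUnpaired D D-bounded)) ha
    vn = trans (sym (lastM-vUnpaired D D-bounded)) (e~-nothing⇒ r D en)

Lowered-step : ∀ r → 1 ≤ r → ∀ {X X'} → Lowered r X X' →
  ∀ j → 1 ≤ j → Pointwise (Lowered r) (E~ j X) (E~ j X')
Lowered-step r 1≤r {X} (Z , eZ , Z≐X') j 1≤j =
  Pointwise.trans (λ {_} {Y} {Y'} (W , eW , W≐Y) Y≐Y' → W , eW , ≐-trans {W} {Y} {Y'} W≐Y Y≐Y')
    (Commutation.E~-Lowered r j 1≤r 1≤j X eZ) (E~-cong j Z≐X')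

corollary5p34 : (D : Diagram) → ValidDiagram D → (r : ℕ) → 1 ≤ r →
    ((e~ r D ≢ nothing) ⇔ (e~ r (rect D) ≢ nothing))
    × (∀ (D₁ D₂ : Diagram) → e~ r D ≡ just D₁ → e~ r (rect D) ≡ just D₂ →
    rect D₁ ≈ᴰ D₂)
corollary5p34 D _ r 1≤r = mk⇔ nonzero-preserved nonzero-reflected , commutes
  where
  rect-lowered : ∀ {D₁} → e~ r D ≡ just D₁ → Lowered r (rect D) (rect D₁)
  rect-lowered {D₁} e₁ = rectF-simulation (Lowered r) (Lowered-step r 1≤r) _ _ {D} {D₁}
    (D₁ , e₁ , λ _ _ → refl) (n<1+n _) (n<1+n _)

  nonzero-preserved : e~ r D ≢ nothing → e~ r (rect D) ≢ nothing
  nonzero-preserved ≢nothing with e~ r D in e₁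
  ... | nothing = ⊥-elim (≢nothing refl)
  ... | just _ with rect-lowered e₁
  ...   | _ , eZ , _ = λ e → case trans (sym eZ) e of λ ()

  nonzero-reflected : e~ r (rect D) ≢ nothing → e~ r D ≢ nothing
  nonzero-reflected ≢nothing e = ≢nothing (rectF-invariant (λ X → e~ r X ≡ nothing)
    (λ j 1≤j en eY → Commutation.e~-E~-silent r j 1≤r 1≤j _ en eY) _ e)

  commutes : ∀ D₁ D₂ → e~ r D ≡ just D₁ → e~ r (rect D) ≡ just D₂ → rect D₁ ≈ᴰ D₂
  commutes D₁ D₂ e₁ e₂ with rect-lowered e₁
  ... | Z , eZ , Z≐rect with just-injective (trans (sym eZ) e₂)
  ...   | refl = ≐⇒≈ᴰ (≐-sym {Z} {rect D₁} Z≐rect)
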